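{- Let $\pi \in Bl_{n,k}$. Then $\mathrm{Ltr}(\pi) = \mathrm{Ltr}(f_n(\pi))$.
   Context: $\S_n(321)$ is the set of $321$-avoiding permutations in $\S_n$. $\mathrm{Ltr}(\pi)=\{i:\pi(i)=\max\{\pi(1),\dots,\pi(i)\}\}$ is the set of left-to-right maxima; $\mathrm{bl}(\pi)=|\{i : \pi(j)\le i \text{ for all } j\le i\}|$ is the block number; $Bl_{n,k}=\{\pi\in\S_n(321):\mathrm{bl}(\pi)=k\}$. Maps $f_n:\S_n(321)\to\S_n(321)$ are defined recursively: $f_1$ is the identity on $\S_1$. For $\pi\in\S_n(321)$, $n\ge2$, let $k=\mathrm{bl}(\pi)$. Case A: $\pi^{ -1}(n)=n$: delete $n$, apply $f_{n-1}$, and insert $n$ at the last position. Case B: $\pi^{ -1}(n-1)<\pi^{ -1}(n)<n$: delete $n$, apply $f_{n-1}$, insert $n$ at the same position as in $\pi$, and multiply on the left by the transposition $(n-k-1,n-k)$. Case C: $\pi^{ -1}(n)<\pi^{ -1}(n-1)$ (so $n-1$ is the last letter): let $\pi'=(n-1,n)\pi$, compute $f_n(\pi')$ as in case A, and multiply it on the left by the cycle $(n-k,n-k+1,\dots,n)$. (Left multiplication acts on the values.) -}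

module Defs where

open import Data.Nat using (ℕ; zero; suc; _∸_; _<_; _≤_; _⊔_; _≟_; _<?_; _≤?_)
open import Data.Nat.Properties using ()
open import Data.Bool using (Bool; true; false; if_then_else_; _∧_)
open import Data.List using (List; []; _∷_; _++_; [_]; map; filter; take; upTo; length; foldr)
open import Data.List.Relation.Unary.All using (All)
open import Data.List.Relation.Unary.All using (all?)
open import Data.List.Relation.Binary.Sublist.Propositional using (_⊆_)
open import Data.List.Relation.Binary.Permutation.Propositional using (_↭_)
open import Data.Product using (∃; _×_)
open import Relation.Nullary using (¬_; does; ¬?)
open import Relation.Binary.PropositionalEquality using (_≡_)

-- Permutations of [n] are written in one-line notation as lists of
-- values 1..n : π = [π(1), ..., π(n)].

range1 : ℕ → List ℕ
range1 n = map suc (upTo n)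

IsPerm : ℕ → List ℕ → Set
IsPerm n π = π ↭ range1 n

Avoids321 : List ℕ → Set
Avoids321 π = ¬ (∃ λ a → ∃ λ b → ∃ λ c → ((a ∷ b ∷ c ∷ []) ⊆ π) × (c < b) × (b < a))

S321 : ℕ → List ℕ → Set
S321 n π = IsPerm n π × Avoids321 π

-- π(i), 1-indexed (0 outside range)
at : List ℕ → ℕ → ℕ
at [] i = 0
at (x ∷ xs) zero = 0
at (x ∷ xs) (suc zero) = x
at (x ∷ xs) (suc (suc i)) = at xs (suc i)

prefMax : List ℕ → ℕ → ℕ
prefMax π i = foldr _⊔_ 0 (take i π)

Ltr : List ℕ → List ℕ
Ltr π = filter (λ i → at π i ≟ prefMax π i) (range1 (length π))

bl : List ℕ → ℕ
bl π = length (filter (λ i → all? (_≤? i) (take i π)) (range1 (length π)))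

Bl : ℕ → ℕ → List ℕ → Set
Bl n k π = S321 n π × bl π ≡ k

-- Auxiliary list operations (positions here are 0-indexed)

deleteVal : ℕ → List ℕ → List ℕ
deleteVal v = filter (λ x → ¬? (x ≟ v))

-- 0-indexed position of the value v (length of list if absent)
posOf : ℕ → List ℕ → ℕ
posOf v [] = 0
posOf v (x ∷ xs) = if does (x ≟ v) then 0 else suc (posOf v xs)

insertAt : ℕ → ℕ → List ℕ → List ℕ
insertAt zero v xs = v ∷ xs
insertAt (suc p) v [] = [ v ]
insertAt (suc p) v (x ∷ xs) = x ∷ insertAt p v xs

-- left multiplication by the transposition (a , b) (acts on values)
transpL : ℕ → ℕ → List ℕ → List ℕ
transpL a b = map (λ x → if does (x ≟ a) then b else (if does (x ≟ b) then a else x))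

-- left multiplication by the cycle (a, a+1, ..., b) : a ↦ a+1 ↦ ... ↦ b ↦ a
cycleL : ℕ → ℕ → List ℕ → List ℕ
cycleL a b = map (λ x → if does (a ≤? x) ∧ does (x <? b) then suc x
                         else (if does (x ≟ b) then a else x))

f : ℕ → List ℕ → List ℕ
f zero π = π
f (suc zero) π = π
f (suc (suc m)) π =
  if does (posOf n π ≟ suc m)                 -- case A: π⁻¹(n) = n
  then f (suc m) (deleteVal n π) ++ [ n ]
  else (if does (posOf (suc m) π <? posOf n π)   -- case B: π⁻¹(n-1) < π⁻¹(n) < n
        then transpL (n ∸ k ∸ 1) (n ∸ k) (insertAt (posOf n π) n (f (suc m) (deleteVal n π)))
        else cycleL (n ∸ k) n
               (f (suc m) (deleteVal n π') ++ [ n ]))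
  where
    n = suc (suc m)
    k = bl π
    π' = transpL (suc m) n π

-- Ltr(π) is determined by the 0/1 vector marking the left-to-right maxima, and f_n
-- preserves that vector. By induction on n, f_n(π) is again a permutation, and if n is
-- not the last letter of π then f_n(π) ends with n − bl(π). In each case of the
-- definition, n occupies the same position in f_n(π) as in π and everything after it is
-- smaller, so only the prefix before n matters. In case A that prefix is f_{n-1}(π ∖ n).
-- In case B deleting n leaves bl unchanged (n − 1 precedes n), so a = n − bl(π) − 1 is
-- the last letter of f_{n-1}(π ∖ n); the prefix avoids a, and exchanging a and a + 1 is
-- order-preserving away from a. In case C, n − 1 follows n; the cycle (n − k … n) sends
-- the n − 1 of f_{n-1}(π′) to n and is order-preserving below n, while the record vector
-- of a permutation split at its maximum determines the record vector of the prefix.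
module Submission where

open import Defs
open import Data.Bool using (Bool; true; false; if_then_else_; _∧_)
open import Data.Bool.Properties using (∧-zeroʳ)
open import Data.Nat using (ℕ; zero; suc; pred; _+_; _∸_; _<_; _≤_; _⊔_; _≟_; _<?_; _≤?_; z≤n; s≤s)
open import Data.Nat.Properties
open import Data.List using (List; []; _∷_; _++_; [_]; map; filter; take; drop; upTo; length; foldr; foldl; replicate)
open import Data.List.Properties
  using (∷-injective; length-map; length-upTo; length-++; length-filter; map-++; map-id-local; ++-assoc; ++-identityʳ;
         take-all; filter-accept; filter-reject; filter-all; filter-++; applyUpTo-∷ʳ)
open import Data.List.Relation.Unary.All as All using (All; []; _∷_; all?)
import Data.List.Relation.Unary.All.Properties as All
open import Data.List.Relation.Unary.Any using (here; there)
open import Data.List.Membership.Propositional using (_∈_; _∉_)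
open import Data.List.Membership.Propositional.Properties
  using (∈-upTo⁻; ∈-upTo⁺; ∈-map⁺; ∈-map⁻; ∈-filter⁺; ∈-filter⁻; ∈-++⁺ˡ; ∈-++⁺ʳ; ∈-∃++)
open import Data.List.Membership.DecPropositional _≟_ using (_∈?_)
open import Data.List.Relation.Unary.Unique.Propositional using (Unique)
import Data.List.Relation.Unary.Unique.Propositional.Properties as Unique
open import Data.List.Relation.Unary.AllPairs using ([]; _∷_)
open import Data.List.Relation.Binary.Permutation.Propositional using (_↭_; ↭-refl; ↭-prep; ↭-swap; ↭-trans; ↭-sym; ↭⇒↭ₛ)
open import Data.List.Relation.Binary.Permutation.Propositional.Properties using (↭-length; ∈-resp-↭; ++-comm)
import Data.List.Relation.Binary.Permutation.Setoid.Properties as Setoid↭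
open import Data.Product using (∃; ∃₂; _×_; _,_; proj₁; proj₂)
open import Data.Empty using (⊥-elim)
open import Data.Sum using (inj₁; inj₂)
open import Relation.Binary.Definitions using (tri<; tri≈; tri>)
open import Function using (id; _∘_)
open import Function.Bundles using (mk⇔)
open import Relation.Nullary using (¬_; Dec; yes; no; does; ¬?)
open import Relation.Nullary.Decidable using (dec-true; dec-false; does-⇔)
open import Relation.Unary using (Decidable)
open import Relation.Binary.PropositionalEquality
  using (_≡_; _≢_; refl; sym; trans; cong; cong₂; subst; subst₂; setoid; module ≡-Reasoning)

if-true : ∀ {A : Set} {b : Bool} {u v : A} → b ≡ true → (if b then u else v) ≡ u
if-true refl = refl

if-false : ∀ {A : Set} {b : Bool} {u v : A} → b ≡ false → (if b then u else v) ≡ v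
if-false refl = refl

filter-≐-on : ∀ {P Q : ℕ → Set} (P? : Decidable P) (Q? : Decidable Q) {xs : List ℕ} →
              All (λ x → does (P? x) ≡ does (Q? x)) xs → filter P? xs ≡ filter Q? xs
filter-≐-on P? Q? [] = refl
filter-≐-on P? Q? {x ∷ xs} (e ∷ es) with does (P? x) | does (Q? x)
... | true  | true  = cong (x ∷_) (filter-≐-on P? Q? es)
... | false | false = filter-≐-on P? Q? es
... | true  | false with () ← e
... | false | true  with () ← e

-- Left-to-right maxima

-- records 0 π is the indicator vector of Ltr(π), shifted to start at index 0.
records : ℕ → List ℕ → List Bool
records m [] = []
records m (x ∷ xs) = does (m ≤? x) ∷ records (m ⊔ x) xs

flag : List Bool → ℕ → Bool
flag [] _ = false
flag (b ∷ bs) zero = b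
flag (b ∷ bs) (suc i) = flag bs i

length-records : ∀ m xs → length (records m xs) ≡ length xs
length-records m [] = refl
length-records m (x ∷ xs) = cong suc (length-records (m ⊔ x) xs)

ltr-test≡flag : ∀ xs m i → i < length xs →
                does (at xs (suc i) ≟ m ⊔ foldr _⊔_ 0 (take (suc i) xs)) ≡ flag (records m xs) i
ltr-test≡flag (x ∷ xs) m zero _ = does-⇔ (mk⇔ to from) (x ≟ m ⊔ (x ⊔ 0)) (m ≤? x)
  where
  to : x ≡ m ⊔ (x ⊔ 0) → m ≤ x
  to e = subst (m ≤_) (sym (trans e (cong (m ⊔_) (⊔-identityʳ x)))) (m≤m⊔n m x)
  from : m ≤ x → x ≡ m ⊔ (x ⊔ 0)
  from m≤x = sym (trans (cong (m ⊔_) (⊔-identityʳ x)) (m≤n⇒m⊔n≡n m≤x))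
ltr-test≡flag (x ∷ xs) m (suc i) (s≤s i<) rewrite sym (⊔-assoc m x (foldr _⊔_ 0 (take (suc i) xs))) =
  ltr-test≡flag xs (m ⊔ x) i i<

Ltr-cong : ∀ xs ys → records 0 xs ≡ records 0 ys → Ltr xs ≡ Ltr ys
Ltr-cong xs ys eq = begin
  Ltr xs
    ≡⟨ filter-≐-on (λ i → at xs i ≟ prefMax xs i) (λ i → at ys i ≟ prefMax ys i)
                   (All.map⁺ (All.applyUpTo⁺₁ id (length xs) same-test)) ⟩
  filter (λ i → at ys i ≟ prefMax ys i) (range1 (length xs))
    ≡⟨ cong (λ L → filter (λ i → at ys i ≟ prefMax ys i) (range1 L)) length≡ ⟩
  Ltr ys ∎
  where
  open ≡-Reasoning
  length≡ : length xs ≡ length ys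
  length≡ = trans (sym (length-records 0 xs)) (trans (cong length eq) (length-records 0 ys))
  same-test : ∀ {i} → i < length xs →
              does (at xs (suc i) ≟ prefMax xs (suc i)) ≡ does (at ys (suc i) ≟ prefMax ys (suc i))
  same-test {i} i< = trans (ltr-test≡flag xs 0 i i<)
                      (trans (cong (λ r → flag r i) eq) (sym (ltr-test≡flag ys 0 i (subst (i <_) length≡ i<))))

records-++ : ∀ m xs ys → records m (xs ++ ys) ≡ records m xs ++ records (foldl _⊔_ m xs) ys
records-++ m [] ys = refl
records-++ m (x ∷ xs) ys = cong (_ ∷_) (records-++ (m ⊔ x) xs ys)

take-records : ∀ p m xs → take p (records m xs) ≡ records m (take p xs)
take-records zero m xs = refl
take-records (suc p) m [] = refl
take-records (suc p) m (x ∷ xs) = cong (_ ∷_) (take-records p (m ⊔ x) xs)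

records-below : ∀ m zs → All (_< m) zs → records m zs ≡ replicate (length zs) false
records-below m [] [] = refl
records-below m (z ∷ zs) (z<m ∷ zs<m) =
  cong₂ _∷_ (dec-false (m ≤? z) (<⇒≱ z<m))
            (trans (cong (λ m′ → records m′ zs) (m≥n⇒m⊔n≡m (<⇒≤ z<m))) (records-below m zs zs<m))

foldl-⊔-lub : ∀ m x xs → m ≤ x → All (_≤ x) xs → foldl _⊔_ m xs ≤ x
foldl-⊔-lub m x [] m≤x [] = m≤x
foldl-⊔-lub m x (y ∷ ys) m≤x (y≤x ∷ ys≤x) = foldl-⊔-lub (m ⊔ y) x ys (⊔-lub m≤x y≤x) ys≤x

records-++-max : ∀ m xs x zs → m ≤ x → All (_≤ x) xs → All (_< x) zs →
                 records m (xs ++ x ∷ zs) ≡ records m xs ++ true ∷ replicate (length zs) false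
records-++-max m xs x zs m≤x xs≤x zs<x =
  trans (records-++ m xs (x ∷ zs)) (cong (records m xs ++_) (cong₂ _∷_ (dec-true (M ≤? x) M≤x) rest))
  where
  M = foldl _⊔_ m xs
  M≤x : M ≤ x
  M≤x = foldl-⊔-lub m x xs m≤x xs≤x
  rest : records (M ⊔ x) zs ≡ replicate (length zs) false
  rest = trans (cong (λ m′ → records m′ zs) (m≤n⇒m⊔n≡n M≤x)) (records-below x zs zs<x)

StrictlyMonotoneOn : (ℕ → Set) → (ℕ → ℕ) → Set
StrictlyMonotoneOn S h = ∀ {x y} → S x → S y → x < y → h x < h y

module _ {S : ℕ → Set} {h : ℕ → ℕ} (h-mono : StrictlyMonotoneOn S h) where

  private
    h-≤ : ∀ {x y} → S x → S y → x ≤ y → h x ≤ h y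
    h-≤ sx sy x≤y with m≤n⇒m<n∨m≡n x≤y
    ... | inj₁ x<y = <⇒≤ (h-mono sx sy x<y)
    ... | inj₂ refl = ≤-refl

    h-≤⁻ : ∀ {x y} → S x → S y → h x ≤ h y → x ≤ y
    h-≤⁻ sx sy hx≤hy = ≮⇒≥ (λ y<x → <⇒≱ (h-mono sy sx y<x) hx≤hy)

    records-map-from : ∀ m m′ xs → All S xs →
                       (∀ {y} → S y → m ≤ y → m′ ≤ h y) → (∀ {y} → S y → m′ ≤ h y → m ≤ y) →
                       records m′ (map h xs) ≡ records m xs
    records-map-from m m′ [] [] _ _ = refl
    records-map-from m m′ (x ∷ xs) (sx ∷ sxs) to from =
      cong₂ _∷_ (does-⇔ (mk⇔ (from sx) (to sx)) (m′ ≤? h x) (m ≤? x))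
                (records-map-from (m ⊔ x) (m′ ⊔ h x) xs sxs to′ from′)
      where
      to′ : ∀ {y} → S y → m ⊔ x ≤ y → m′ ⊔ h x ≤ h y
      to′ sy le = ⊔-lub (to sy (m⊔n≤o⇒m≤o m x le)) (h-≤ sx sy (m⊔n≤o⇒n≤o m x le))
      from′ : ∀ {y} → S y → m′ ⊔ h x ≤ h y → m ⊔ x ≤ y
      from′ sy le = ⊔-lub (from sy (m⊔n≤o⇒m≤o m′ (h x) le)) (h-≤⁻ sx sy (m⊔n≤o⇒n≤o m′ (h x) le))

  records-map : ∀ xs → All S xs → records 0 (map h xs) ≡ records 0 xs
  records-map xs sxs = records-map-from 0 0 xs sxs (λ _ _ → z≤n) (λ _ _ → z≤n)

falses≢true : ∀ i (q r : List Bool) → replicate i false ≢ q ++ true ∷ r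
falses≢true zero [] r ()
falses≢true zero (_ ∷ q) r ()
falses≢true (suc i) [] r ()
falses≢true (suc i) (_ ∷ q) r e = falses≢true i q r (proj₂ (∷-injective e))

++-true∷falses-injectiveˡ : ∀ (p q : List Bool) i j →
                            p ++ true ∷ replicate i false ≡ q ++ true ∷ replicate j false → p ≡ q
++-true∷falses-injectiveˡ [] [] i j e = refl
++-true∷falses-injectiveˡ [] (b ∷ q) i j e = ⊥-elim (falses≢true i q _ (proj₂ (∷-injective e)))
++-true∷falses-injectiveˡ (b ∷ p) [] i j e = ⊥-elim (falses≢true j p _ (sym (proj₂ (∷-injective e))))
++-true∷falses-injectiveˡ (b ∷ p) (c ∷ q) i j e =
  cong₂ _∷_ (proj₁ (∷-injective e)) (++-true∷falses-injectiveˡ p q i j (proj₂ (∷-injective e)))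

-- Permutations in one-line notation

infix 4 _∈[1,_]
_∈[1,_] : ℕ → ℕ → Set
x ∈[1, n ] = 1 ≤ x × x ≤ n

-- Equivalent to IsPerm, but transported along map, insertAt and deleteVal more easily than ↭.
record Perm (n : ℕ) (xs : List ℕ) : Set where
  field
    length≡  : length xs ≡ n
    unique   : Unique xs
    bounded  : ∀ {x} → x ∈ xs → x ∈[1, n ]
    complete : ∀ {x} → x ∈[1, n ] → x ∈ xs

open Perm

Perm-resp-↭ : ∀ {n xs ys} → xs ↭ ys → Perm n xs → Perm n ys
Perm-resp-↭ xs↭ys p = record
  { length≡  = trans (sym (↭-length xs↭ys)) (length≡ p)
  ; unique   = Setoid↭.Unique-resp-↭ (setoid ℕ) (↭⇒↭ₛ xs↭ys) (unique p)
  ; bounded  = λ x∈ → bounded p (∈-resp-↭ (↭-sym xs↭ys) x∈)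
  ; complete = λ x∈[1,n] → ∈-resp-↭ xs↭ys (complete p x∈[1,n])
  }

range1-Perm : ∀ n → Perm n (range1 n)
range1-Perm n = record
  { length≡  = trans (length-map suc (upTo n)) (length-upTo n)
  ; unique   = Unique.map⁺ suc-injective (Unique.upTo⁺ n)
  ; bounded  = bounded′
  ; complete = complete′
  }
  where
  bounded′ : ∀ {x} → x ∈ range1 n → x ∈[1, n ]
  bounded′ x∈ with ∈-map⁻ suc x∈
  ... | _ , y∈ , refl = s≤s z≤n , ∈-upTo⁻ y∈
  complete′ : ∀ {x} → x ∈[1, n ] → x ∈ range1 n
  complete′ {suc x} (_ , x<n) = ∈-map⁺ suc (∈-upTo⁺ x<n)

IsPerm⇒Perm : ∀ {n π} → IsPerm n π → Perm n π
IsPerm⇒Perm {n} π↭ = Perm-resp-↭ (↭-sym π↭) (range1-Perm n)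

Perm-∷-max : ∀ {n xs} → Perm n xs → Perm (suc n) (suc n ∷ xs)
Perm-∷-max {n} {xs} p = record
  { length≡  = cong suc (length≡ p)
  ; unique   = All.tabulate (λ x∈ e → 1+n≰n (subst (_≤ n) (sym e) (proj₂ (bounded p x∈)))) ∷ unique p
  ; bounded  = bounded′
  ; complete = complete′
  }
  where
  bounded′ : ∀ {x} → x ∈ suc n ∷ xs → x ∈[1, suc n ]
  bounded′ (here refl) = s≤s z≤n , ≤-refl
  bounded′ (there x∈) = proj₁ (bounded p x∈) , m≤n⇒m≤1+n (proj₂ (bounded p x∈))
  complete′ : ∀ {x} → x ∈[1, suc n ] → x ∈ suc n ∷ xs
  complete′ {x} (1≤x , x≤1+n) with x ≟ suc n
  ... | yes refl = here refl
  ... | no x≢1+n = there (complete p (1≤x , ≤-pred (≤∧≢⇒< x≤1+n x≢1+n)))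

insertAt-↭ : ∀ p v xs → insertAt p v xs ↭ v ∷ xs
insertAt-↭ zero v xs = ↭-refl
insertAt-↭ (suc p) v [] = ↭-refl
insertAt-↭ (suc p) v (x ∷ xs) = ↭-trans (↭-prep x (insertAt-↭ p v xs)) (↭-swap x v ↭-refl)

Perm-insertAt : ∀ {n xs} p → Perm n xs → Perm (suc n) (insertAt p (suc n) xs)
Perm-insertAt p p′ = Perm-resp-↭ (↭-sym (insertAt-↭ p _ _)) (Perm-∷-max p′)

Perm-∷ʳ : ∀ {n xs} → Perm n xs → Perm (suc n) (xs ++ [ suc n ])
Perm-∷ʳ {n} {xs} p = Perm-resp-↭ (++-comm [ suc n ] xs) (Perm-∷-max p)

deleteVal-∉ : ∀ {v xs} → v ∉ xs → deleteVal v xs ≡ xs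
deleteVal-∉ {v} {xs} v∉ = filter-all (λ y → ¬? (y ≟ v)) (All.tabulate (λ x∈ x≡v → v∉ (subst (_∈ xs) x≡v x∈)))

deleteVal-++ : ∀ {v} α β → v ∉ α → v ∉ β → deleteVal v (α ++ v ∷ β) ≡ α ++ β
deleteVal-++ {v} α β v∉α v∉β = begin
  deleteVal v (α ++ v ∷ β)              ≡⟨ filter-++ (λ y → ¬? (y ≟ v)) α (v ∷ β) ⟩
  deleteVal v α ++ deleteVal v (v ∷ β)  ≡⟨ cong₂ _++_ (deleteVal-∉ v∉α) (filter-reject (λ y → ¬? (y ≟ v)) (λ v≢v → v≢v refl)) ⟩
  α ++ deleteVal v β                    ≡⟨ cong (α ++_) (deleteVal-∉ v∉β) ⟩
  α ++ β                                ∎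
  where open ≡-Reasoning

length-deleteVal : ∀ {v xs} → Unique xs → v ∈ xs → suc (length (deleteVal v xs)) ≡ length xs
length-deleteVal {v} {x ∷ xs} (x∉xs ∷ _) (here refl) =
  cong suc (trans (cong length (filter-reject (λ y → ¬? (y ≟ v)) (λ v≢v → v≢v refl)))
                  (cong length (deleteVal-∉ (All.All¬⇒¬Any x∉xs))))
length-deleteVal {v} {x ∷ xs} (x∉xs ∷ u) (there v∈) =
  trans (cong (suc ∘ length) (filter-accept (λ y → ¬? (y ≟ v)) (λ x≡v → All.lookup x∉xs v∈ x≡v)))
        (cong suc (length-deleteVal u v∈))

Perm-deleteVal : ∀ {n xs} → Perm (suc n) xs → Perm n (deleteVal (suc n) xs)
Perm-deleteVal {n} {xs} p = record
  { length≡  = suc-injective (trans (length-deleteVal (unique p) (complete p (s≤s z≤n , ≤-refl))) (length≡ p))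
  ; unique   = Unique.filter⁺ (λ y → ¬? (y ≟ suc n)) (unique p)
  ; bounded  = λ x∈ → let (x∈xs , x≢) = ∈-filter⁻ (λ y → ¬? (y ≟ suc n)) x∈
                      in proj₁ (bounded p x∈xs) , ≤-pred (≤∧≢⇒< (proj₂ (bounded p x∈xs)) x≢)
  ; complete = λ (1≤x , x≤n) → ∈-filter⁺ (λ y → ¬? (y ≟ suc n)) (complete p (1≤x , m≤n⇒m≤1+n x≤n))
                                         (λ e → 1+n≰n (subst (_≤ n) e x≤n))
  }

Perm-map : ∀ {n xs} (h h⁻¹ : ℕ → ℕ) → (∀ x → h⁻¹ (h x) ≡ x) →
           (∀ {x} → x ∈[1, n ] → h x ∈[1, n ]) →
           (∀ {y} → y ∈[1, n ] → h⁻¹ y ∈[1, n ] × h (h⁻¹ y) ≡ y) →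
           Perm n xs → Perm n (map h xs)
Perm-map {n} {xs} h h⁻¹ h⁻¹∘h h-range h-onto p = record
  { length≡  = trans (length-map h xs) (length≡ p)
  ; unique   = Unique.map⁺ (λ {x} {y} e → trans (sym (h⁻¹∘h x)) (trans (cong h⁻¹ e) (h⁻¹∘h y))) (unique p)
  ; bounded  = bounded′
  ; complete = λ y∈ → let (x∈ , hx≡y) = h-onto y∈ in subst (_∈ map h xs) hx≡y (∈-map⁺ h (complete p x∈))
  }
  where
  bounded′ : ∀ {y} → y ∈ map h xs → y ∈[1, n ]
  bounded′ y∈ with ∈-map⁻ h y∈
  ... | x , x∈ , refl = h-range (bounded p x∈)

-- transpL a b and cycleL c n are, definitionally, map (swap a b) and map (rotate c n).
swap : ℕ → ℕ → ℕ → ℕ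
swap a b x = if does (x ≟ a) then b else (if does (x ≟ b) then a else x)

swap-left : ∀ a b → swap a b a ≡ b
swap-left a b = if-true (dec-true (a ≟ a) refl)

swap-right : ∀ a b → swap a b b ≡ a
swap-right a b with b ≟ a
... | yes b≡a = trans (if-true (dec-true (b ≟ a) b≡a)) b≡a
... | no b≢a = trans (if-false (dec-false (b ≟ a) b≢a)) (if-true (dec-true (b ≟ b) refl))

swap-other : ∀ {a b x} → x ≢ a → x ≢ b → swap a b x ≡ x
swap-other {a} {b} {x} x≢a x≢b = trans (if-false (dec-false (x ≟ a) x≢a)) (if-false (dec-false (x ≟ b) x≢b))

swap-involutive : ∀ a b x → swap a b (swap a b x) ≡ x
swap-involutive a b x with x ≟ a | x ≟ b
... | yes refl | _ = trans (cong (swap x b) (swap-left x b)) (swap-right x b)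
... | no _ | yes refl = trans (cong (swap a x) (swap-right a x)) (swap-left a x)
... | no x≢a | no x≢b = trans (cong (swap a b) (swap-other x≢a x≢b)) (swap-other x≢a x≢b)

swap-∈[1,] : ∀ {n a b x} → a ∈[1, n ] → b ∈[1, n ] → x ∈[1, n ] → swap a b x ∈[1, n ]
swap-∈[1,] {n} {a} {b} {x} a∈ b∈ x∈ with x ≟ a | x ≟ b
... | yes refl | _ = subst (_∈[1, n ]) (sym (swap-left x b)) b∈
... | no _ | yes refl = subst (_∈[1, n ]) (sym (swap-right a x)) a∈
... | no x≢a | no x≢b = subst (_∈[1, n ]) (sym (swap-other x≢a x≢b)) x∈

Perm-transpL : ∀ {n a b xs} → a ∈[1, n ] → b ∈[1, n ] → Perm n xs → Perm n (transpL a b xs)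
Perm-transpL {a = a} {b} a∈ b∈ =
  Perm-map (swap a b) (swap a b) (swap-involutive a b) (swap-∈[1,] a∈ b∈)
           (λ y∈ → swap-∈[1,] a∈ b∈ y∈ , swap-involutive a b _)

swap-mono : ∀ a → StrictlyMonotoneOn (_≢ a) (swap a (suc a))
swap-mono a {x} {y} x≢a y≢a x<y with x ≟ suc a | y ≟ suc a
... | yes refl | yes refl = ⊥-elim (<-irrefl refl x<y)
... | yes refl | no y≢1+a =
  subst₂ _<_ (sym (swap-right a (suc a))) (sym (swap-other y≢a y≢1+a)) (<-trans (n<1+n a) x<y)
... | no x≢1+a | yes refl =
  subst₂ _<_ (sym (swap-other x≢a x≢1+a)) (sym (swap-right a (suc a))) (≤∧≢⇒< (≤-pred x<y) x≢a)
... | no x≢1+a | no y≢1+a = subst₂ _<_ (sym (swap-other x≢a x≢1+a)) (sym (swap-other y≢a y≢1+a)) x<y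

rotate : ℕ → ℕ → ℕ → ℕ
rotate c n x = if does (c ≤? x) ∧ does (x <? n) then suc x else (if does (x ≟ n) then c else x)

unrotate : ℕ → ℕ → ℕ → ℕ
unrotate c n y = if does (y <? c) then y else (if does (y ≟ c) then n else (if does (y ≤? n) then pred y else y))

data Position (c n x : ℕ) : Set where
  below  : x < c → Position c n x
  inside : c ≤ x → x < n → Position c n x
  top    : x ≡ n → Position c n x
  above  : n < x → Position c n x

position : ∀ c n x → Position c n x
position c n x with x <? c
... | yes x<c = below x<c
... | no x≮c with <-cmp x n
...   | tri< x<n _ _ = inside (≮⇒≥ x≮c) x<n
...   | tri≈ _ x≡n _ = top x≡n
...   | tri> _ _ n<x = above n<x

module _ {c n : ℕ} where

  rotate-below : ∀ {x} → c ≤ n → x < c → rotate c n x ≡ x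
  rotate-below {x} c≤n x<c =
    trans (if-false (cong (_∧ does (x <? n)) (dec-false (c ≤? x) (<⇒≱ x<c))))
          (if-false (dec-false (x ≟ n) (λ x≡n → <⇒≱ x<c (subst (c ≤_) (sym x≡n) c≤n))))

  rotate-inside : ∀ {x} → c ≤ x → x < n → rotate c n x ≡ suc x
  rotate-inside {x} c≤x x<n = if-true (cong₂ _∧_ (dec-true (c ≤? x) c≤x) (dec-true (x <? n) x<n))

  rotate-top : rotate c n n ≡ c
  rotate-top = trans (if-false (trans (cong (does (c ≤? n) ∧_) (dec-false (n <? n) (n≮n n))) (∧-zeroʳ _)))
                     (if-true (dec-true (n ≟ n) refl))

  rotate-above : ∀ {x} → n < x → rotate c n x ≡ x
  rotate-above {x} n<x =
    trans (if-false (trans (cong (does (c ≤? x) ∧_) (dec-false (x <? n) (<⇒≯ n<x))) (∧-zeroʳ _)))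
          (if-false (dec-false (x ≟ n) (>⇒≢ n<x)))

  unrotate-below : ∀ {y} → y < c → unrotate c n y ≡ y
  unrotate-below {y} y<c = if-true (dec-true (y <? c) y<c)

  unrotate-start : unrotate c n c ≡ n
  unrotate-start = trans (if-false (dec-false (c <? c) (n≮n c))) (if-true (dec-true (c ≟ c) refl))

  unrotate-inside : ∀ {y} → c < y → y ≤ n → unrotate c n y ≡ pred y
  unrotate-inside {y} c<y y≤n =
    trans (if-false (dec-false (y <? c) (<⇒≯ c<y)))
          (trans (if-false (dec-false (y ≟ c) (>⇒≢ c<y))) (if-true (dec-true (y ≤? n) y≤n)))

  unrotate-above : ∀ {y} → c ≤ n → n < y → unrotate c n y ≡ y
  unrotate-above {y} c≤n n<y =
    trans (if-false (dec-false (y <? c) (<⇒≯ c<y)))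
          (trans (if-false (dec-false (y ≟ c) (>⇒≢ c<y))) (if-false (dec-false (y ≤? n) (<⇒≱ n<y))))
    where c<y = ≤-<-trans c≤n n<y

  unrotate-rotate : c ≤ n → ∀ x → unrotate c n (rotate c n x) ≡ x
  unrotate-rotate c≤n x with position c n x
  ... | below x<c = trans (cong (unrotate c n) (rotate-below c≤n x<c)) (unrotate-below x<c)
  ... | inside c≤x x<n = trans (cong (unrotate c n) (rotate-inside c≤x x<n)) (unrotate-inside (s≤s c≤x) x<n)
  ... | top refl = trans (cong (unrotate c n) rotate-top) unrotate-start
  ... | above n<x = trans (cong (unrotate c n) (rotate-above n<x)) (unrotate-above c≤n n<x)

  rotate-∈[1,] : ∀ {x} → c ∈[1, n ] → x ∈[1, n ] → rotate c n x ∈[1, n ]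
  rotate-∈[1,] {x} c∈@(_ , c≤n) x∈@(_ , x≤n) with position c n x
  ... | below x<c = subst (_∈[1, n ]) (sym (rotate-below c≤n x<c)) x∈
  ... | inside c≤x x<n = subst (_∈[1, n ]) (sym (rotate-inside c≤x x<n)) (s≤s z≤n , x<n)
  ... | top refl = subst (_∈[1, n ]) (sym rotate-top) c∈
  ... | above n<x = ⊥-elim (<⇒≱ n<x x≤n)

  rotate-onto : ∀ {y} → c ∈[1, n ] → y ∈[1, n ] → unrotate c n y ∈[1, n ] × rotate c n (unrotate c n y) ≡ y
  rotate-onto {y} (1≤c , c≤n) y∈@(_ , y≤n) with <-cmp y c
  ... | tri< y<c _ _ = subst (_∈[1, n ]) (sym (unrotate-below y<c)) y∈
                     , trans (cong (rotate c n) (unrotate-below y<c)) (rotate-below c≤n y<c)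
  ... | tri≈ _ refl _ = subst (_∈[1, n ]) (sym unrotate-start) (≤-trans 1≤c c≤n , ≤-refl)
                      , trans (cong (rotate c n) unrotate-start) rotate-top
  ... | tri> _ _ c<y@(s≤s c≤y′) = subst (_∈[1, n ]) (sym (unrotate-inside c<y y≤n)) (≤-trans 1≤c c≤y′ , <⇒≤ y′<n)
                                , trans (cong (rotate c n) (unrotate-inside c<y y≤n)) (rotate-inside c≤y′ y′<n)
    where y′<n = y≤n

  Perm-cycleL : ∀ {xs} → c ∈[1, n ] → Perm n xs → Perm n (cycleL c n xs)
  Perm-cycleL c∈ = Perm-map (rotate c n) (unrotate c n) (unrotate-rotate (proj₂ c∈)) (rotate-∈[1,] c∈) (rotate-onto c∈)

  rotate-mono : c ≤ n → StrictlyMonotoneOn (_< n) (rotate c n)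
  rotate-mono c≤n {x} {y} x<n y<n x<y with position c n x | position c n y
  ... | below x<c | below y<c = subst₂ _<_ (sym (rotate-below c≤n x<c)) (sym (rotate-below c≤n y<c)) x<y
  ... | below x<c | inside c≤y _ = subst₂ _<_ (sym (rotate-below c≤n x<c)) (sym (rotate-inside c≤y y<n)) (m<n⇒m<1+n x<y)
  ... | inside c≤x _ | below y<c = ⊥-elim (<⇒≱ (<-trans x<y y<c) c≤x)
  ... | inside c≤x _ | inside c≤y _ = subst₂ _<_ (sym (rotate-inside c≤x x<n)) (sym (rotate-inside c≤y y<n)) (s≤s x<y)
  ... | top refl | _ = ⊥-elim (n≮n x x<n)
  ... | above n<x | _ = ⊥-elim (<-asym n<x x<n)
  ... | _ | top refl = ⊥-elim (n≮n y y<n)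
  ... | _ | above n<y = ⊥-elim (<-asym n<y y<n)

Unique-∉ˡ : ∀ (α : List ℕ) {v β} → Unique (α ++ v ∷ β) → v ∉ α
Unique-∉ˡ (x ∷ α) (x∉ ∷ _) (here refl) = All.lookup x∉ (∈-++⁺ʳ α (here refl)) refl
Unique-∉ˡ (x ∷ α) (_ ∷ u) (there v∈α) = Unique-∉ˡ α u v∈α

Unique-∉ʳ : ∀ (α : List ℕ) {v β} → Unique (α ++ v ∷ β) → v ∉ β
Unique-∉ʳ [] (v∉β ∷ _) = All.All¬⇒¬Any v∉β
Unique-∉ʳ (x ∷ α) (_ ∷ u) = Unique-∉ʳ α u

module _ {n : ℕ} {α β : List ℕ} (p : Perm n (α ++ n ∷ β)) where

  Perm-before-max : All (_≤ n) α
  Perm-before-max = All.tabulate (λ x∈ → proj₂ (bounded p (∈-++⁺ˡ x∈)))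

  Perm-after-max : All (_< n) β
  Perm-after-max = All.tabulate (λ {x} x∈ → ≤∧≢⇒< (proj₂ (bounded p (∈-++⁺ʳ α (there x∈))))
                                                  (λ x≡n → Unique-∉ʳ α (unique p) (subst (_∈ β) x≡n x∈)))

  records-max-split : records 0 (α ++ n ∷ β) ≡ records 0 α ++ true ∷ replicate (length β) false
  records-max-split = records-++-max 0 α n β z≤n Perm-before-max Perm-after-max

module _ {n : ℕ} {α β α′ β′ : List ℕ} (p : Perm n (α ++ n ∷ β)) (p′ : Perm n (α′ ++ n ∷ β′)) where

  records-max-split-cong : records 0 α ≡ records 0 α′ → records 0 (α ++ n ∷ β) ≡ records 0 (α′ ++ n ∷ β′)
  records-max-split-cong eq = begin
    records 0 (α ++ n ∷ β)                          ≡⟨ records-max-split p ⟩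
    records 0 α ++ true ∷ replicate (length β) false ≡⟨ cong₂ (λ r k → r ++ true ∷ replicate k false) eq |β|≡|β′| ⟩
    records 0 α′ ++ true ∷ replicate (length β′) false ≡⟨ sym (records-max-split p′) ⟩
    records 0 (α′ ++ n ∷ β′)                        ∎
    where
    open ≡-Reasoning
    |α|≡|α′| : length α ≡ length α′
    |α|≡|α′| = trans (sym (length-records 0 α)) (trans (cong length eq) (length-records 0 α′))
    |β|≡|β′| : length β ≡ length β′
    |β|≡|β′| = suc-injective (+-cancelˡ-≡ (length α) _ _ (begin
      length α + suc (length β)    ≡⟨ sym (length-++ α) ⟩
      length (α ++ n ∷ β)          ≡⟨ trans (length≡ p) (sym (length≡ p′)) ⟩
      length (α′ ++ n ∷ β′)        ≡⟨ length-++ α′ ⟩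
      length α′ + suc (length β′)  ≡⟨ cong (_+ _) (sym |α|≡|α′|) ⟩
      length α + suc (length β′)   ∎))

  records-max-split-injective : records 0 (α ++ n ∷ β) ≡ records 0 (α′ ++ n ∷ β′) → records 0 α ≡ records 0 α′
  records-max-split-injective eq = ++-true∷falses-injectiveˡ _ _ (length β) (length β′)
    (trans (sym (records-max-split p)) (trans eq (records-max-split p′)))

posOf-head : ∀ v ys → posOf v (v ∷ ys) ≡ 0
posOf-head v ys = if-true (dec-true (v ≟ v) refl)

posOf-++-∉ : ∀ {v} α ys → v ∉ α → posOf v (α ++ ys) ≡ length α + posOf v ys
posOf-++-∉ [] ys _ = refl
posOf-++-∉ {v} (x ∷ α) ys v∉ =
  trans (if-false (dec-false (x ≟ v) (λ x≡v → v∉ (here (sym x≡v))))) (cong suc (posOf-++-∉ α ys (v∉ ∘ there)))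

posOf-++-∈ : ∀ {v} α ys → v ∈ α → posOf v (α ++ ys) < length α
posOf-++-∈ {v} (x ∷ α) ys v∈ with x ≟ v
... | yes x≡v = subst (_< suc (length α)) (sym (if-true (dec-true (x ≟ v) x≡v))) (s≤s z≤n)
... | no x≢v with v∈
...   | here v≡x = ⊥-elim (x≢v (sym v≡x))
...   | there v∈α = subst (_< suc (length α)) (sym (if-false (dec-false (x ≟ v) x≢v))) (s≤s (posOf-++-∈ α ys v∈α))

posOf-split : ∀ {v} α β → v ∉ α → posOf v (α ++ v ∷ β) ≡ length α
posOf-split {v} α β v∉ = trans (posOf-++-∉ α (v ∷ β) v∉) (trans (cong (length α +_) (posOf-head v β)) (+-identityʳ _))

insertAt-take-drop : ∀ p v xs → insertAt p v xs ≡ take p xs ++ v ∷ drop p xs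
insertAt-take-drop zero v xs = refl
insertAt-take-drop (suc p) v [] = refl
insertAt-take-drop (suc p) v (x ∷ xs) = cong (x ∷_) (insertAt-take-drop p v xs)

insertAt-++ : ∀ p v xs zs → p ≤ length xs → insertAt p v (xs ++ zs) ≡ insertAt p v xs ++ zs
insertAt-++ zero v xs zs _ = refl
insertAt-++ (suc p) v (x ∷ xs) zs (s≤s p≤) = cong (x ∷_) (insertAt-++ p v xs zs p≤)

take-++ˡ : ∀ {A : Set} k (xs ys : List A) → k ≤ length xs → take k (xs ++ ys) ≡ take k xs
take-++ˡ zero xs ys _ = refl
take-++ˡ (suc k) (x ∷ xs) ys (s≤s k≤) = cong (x ∷_) (take-++ˡ k xs ys k≤)

take-length-++ : ∀ {A : Set} (xs ys : List A) → take (length xs) (xs ++ ys) ≡ xs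
take-length-++ xs ys = trans (take-++ˡ (length xs) xs ys ≤-refl) (take-all (length xs) xs ≤-refl)

∈-take-++ : ∀ {x} k α (ys : List ℕ) → x ∈ α → length α ≤ k → x ∈ take k (α ++ ys)
∈-take-++ (suc k) (y ∷ α) ys (here x≡y) _ = here x≡y
∈-take-++ (suc k) (y ∷ α) ys (there x∈) (s≤s |α|≤k) = there (∈-take-++ k α ys x∈ |α|≤k)

∈-take-++-∷ : ∀ k α v (ys : List ℕ) → length α < k → v ∈ take k (α ++ v ∷ ys)
∈-take-++-∷ (suc k) [] v ys _ = here refl
∈-take-++-∷ (suc k) (x ∷ α) v ys (s≤s |α|<k) = there (∈-take-++-∷ k α v ys |α|<k)

-- Block numbers

boundary? : (π : List ℕ) (i : ℕ) → Dec (All (_≤ i) (take i π))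
boundary? π i = all? (_≤? i) (take i π)

blocks : List ℕ → ℕ → ℕ
blocks π i = length (filter (boundary? π) (range1 i))

range1-suc : ∀ i → range1 (suc i) ≡ range1 i ++ [ suc i ]
range1-suc i = trans (cong (map suc) (sym (applyUpTo-∷ʳ id i))) (map-++ suc (upTo i) [ i ])

blocks-suc : ∀ π i → blocks π (suc i) ≡ blocks π i + length (filter (boundary? π) [ suc i ])
blocks-suc π i = trans (cong (length ∘ filter (boundary? π)) (range1-suc i))
                       (trans (cong length (filter-++ (boundary? π) (range1 i) [ suc i ])) (length-++ (filter (boundary? π) (range1 i))))

not-boundary : ∀ {π i x} → x ∈ take i π → i < x → ¬ All (_≤ i) (take i π)
not-boundary x∈ i<x bd = <⇒≱ i<x (All.lookup bd x∈)

blocks-suc-boundary : ∀ π i → All (_≤ suc i) (take (suc i) π) → blocks π (suc i) ≡ blocks π i + 1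
blocks-suc-boundary π i bd = trans (blocks-suc π i) (cong (λ l → blocks π i + length l) (filter-accept (boundary? π) bd))

blocks-suc-inner : ∀ π i {x} → x ∈ take (suc i) π → suc i < x → blocks π (suc i) ≡ blocks π i
blocks-suc-inner π i x∈ i<x =
  trans (blocks-suc π i) (trans (cong (λ l → blocks π i + length l) (filter-reject (boundary? π) (not-boundary x∈ i<x)))
                                (+-identityʳ _))

blocks-≤ : ∀ π i → blocks π i ≤ i
blocks-≤ π i = subst (blocks π i ≤_) (trans (length-map suc (upTo i)) (length-upTo i)) (length-filter (boundary? π) (range1 i))

blocks-cong : ∀ π π′ j → (∀ {i} → i < j → does (boundary? π (suc i)) ≡ does (boundary? π′ (suc i))) →
              blocks π j ≡ blocks π′ j
blocks-cong π π′ j same = cong length (filter-≐-on (boundary? π) (boundary? π′) (All.map⁺ (All.applyUpTo⁺₁ id j same)))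

bl-via-blocks : ∀ {n π} → Perm (suc n) π → bl π ≡ blocks π n + 1
bl-via-blocks {n} {π} p = trans (cong (blocks π) (length≡ p))
  (blocks-suc-boundary π n (All.take⁺ (suc n) (All.tabulate (λ x∈ → proj₂ (bounded p x∈)))))

1≤bl : ∀ {n π} → Perm (suc n) π → 1 ≤ bl π
1≤bl {n} {π} p = subst (1 ≤_) (sym (bl-via-blocks p)) (m≤n+m 1 (blocks π n))

bl≤ : ∀ {n π x} → Perm (suc n) π → x ∈ take n π → n < x → bl π ≤ n
bl≤ {suc i} {π} p x∈ n<x =
  subst (_≤ suc i) (sym (trans (bl-via-blocks p) (cong (_+ 1) (blocks-suc-inner π i x∈ n<x))))
        (subst (blocks π i + 1 ≤_) (+-comm i 1) (+-monoˡ-≤ 1 (blocks-≤ π i)))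

length-before-two : ∀ {m} (α : List ℕ) x y β → length (α ++ x ∷ y ∷ β) ≡ suc (suc m) → length α ≤ m
length-before-two α x y β e = subst (length α ≤_) (suc-injective (suc-injective |xs|≡)) (m≤m+n (length α) (length β))
  where
  |xs|≡ : suc (suc (length α + length β)) ≡ _
  |xs|≡ = trans (sym (trans (length-++ α) (trans (+-suc (length α) _) (cong suc (+-suc (length α) (length β)))))) e

-- The three cases in the definition of f

EndsWith : ℕ → List ℕ → Set
EndsWith n π = ∃ λ ys → f n π ≡ ys ++ [ n ∸ bl π ]

data Case (m : ℕ) : List ℕ → Set where
  caseA : ∀ α → Case m (α ++ [ suc (suc m) ])
  caseB : ∀ α b β → suc m ∈ α → Case m (α ++ suc (suc m) ∷ b ∷ β)
  caseC : ∀ α b β → suc m ∉ α → Case m (α ++ suc (suc m) ∷ b ∷ β)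

case : ∀ {m π} → Perm (suc (suc m)) π → Case m π
case {m} p with ∈-∃++ (complete p (s≤s z≤n , ≤-refl))
... | α , [] , refl = caseA α
... | α , b ∷ β , refl with suc m ∈? α
...   | yes m+1∈α = caseB α b β m+1∈α
...   | no m+1∉α = caseC α b β m+1∉α

module CaseA {m : ℕ} (α : List ℕ) (p : Perm (suc (suc m)) (α ++ [ suc (suc m) ])) where

  private
    N = suc (suc m)

  N∉α : N ∉ α
  N∉α = Unique-∉ˡ α (unique p)

  deleted : deleteVal N (α ++ [ N ]) ≡ α
  deleted = trans (deleteVal-++ α [] N∉α (λ ())) (++-identityʳ α)

  α-perm : Perm (suc m) α
  α-perm = subst (Perm (suc m)) deleted (Perm-deleteVal p)

  posOf-N : posOf N (α ++ [ N ]) ≡ suc m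
  posOf-N = trans (posOf-split α [] N∉α) (length≡ α-perm)

  unfold : f N (α ++ [ N ]) ≡ f (suc m) α ++ [ N ]
  unfold = trans (if-true (dec-true (posOf N (α ++ [ N ]) ≟ suc m) posOf-N))
                 (cong (λ σ → f (suc m) σ ++ [ N ]) deleted)

module CaseB {m : ℕ} (α : List ℕ) (b : ℕ) (β : List ℕ)
             (p : Perm (suc (suc m)) (α ++ suc (suc m) ∷ b ∷ β)) (m+1∈α : suc m ∈ α) where

  private
    N = suc (suc m)
    π = α ++ N ∷ b ∷ β
    L = length α

  σ : List ℕ
  σ = α ++ b ∷ β

  L≤m : L ≤ m
  L≤m = length-before-two α N b β (length≡ p)

  deleted : deleteVal N π ≡ σ
  deleted = deleteVal-++ α (b ∷ β) (Unique-∉ˡ α (unique p)) (Unique-∉ʳ α (unique p))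

  σ-perm : Perm (suc m) σ
  σ-perm = subst (Perm (suc m)) deleted (Perm-deleteVal p)

  -- From the position of n − 1 on, neither σ nor π has a block boundary before its end.
  bl-σ : bl σ ≡ bl π
  bl-σ = begin
    bl σ           ≡⟨ bl-via-blocks σ-perm ⟩
    blocks σ m + 1 ≡⟨ cong (_+ 1) (blocks-cong σ π m same-boundaries) ⟩
    blocks π m + 1 ≡⟨ cong (_+ 1) (sym (blocks-suc-inner π m (∈-take-++-∷ (suc m) α N (b ∷ β) (s≤s L≤m)) ≤-refl)) ⟩
    blocks π (suc m) + 1 ≡⟨ sym (bl-via-blocks p) ⟩
    bl π           ∎
    where
    open ≡-Reasoning
    same-boundaries : ∀ {i} → i < m → does (boundary? σ (suc i)) ≡ does (boundary? π (suc i))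
    same-boundaries {i} i<m with suc i ≤? L
    ... | yes i<L = cong (λ l → does (all? (_≤? suc i) l))
                         (trans (take-++ˡ (suc i) α (b ∷ β) i<L) (sym (take-++ˡ (suc i) α (N ∷ b ∷ β) i<L)))
    ... | no i≮L =
      trans (dec-false (boundary? σ (suc i)) (not-boundary (∈-take-++ (suc i) α (b ∷ β) m+1∈α L≤i) (s≤s i<m)))
            (sym (dec-false (boundary? π (suc i))
                            (not-boundary (∈-take-++-∷ (suc i) α N (b ∷ β) (≰⇒> i≮L)) (s≤s (m<n⇒m<1+n i<m)))))
      where L≤i = <⇒≤ (≰⇒> i≮L)

  bl≤m : bl π ≤ m
  bl≤m = subst (_≤ m) bl-σ (bl≤ σ-perm (∈-take-++ m α (b ∷ β) m+1∈α L≤m) ≤-refl)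

  a : ℕ
  a = suc m ∸ bl π

  1≤a : 1 ≤ a
  1≤a = m<n⇒0<n∸m (s≤s bl≤m)

  N∸bl≡1+a : N ∸ bl π ≡ suc a
  N∸bl≡1+a = +-∸-assoc 1 (m≤n⇒m≤1+n bl≤m)

  1+a≤m+1 : suc a ≤ suc m
  1+a≤m+1 = subst (_≤ suc m) N∸bl≡1+a (∸-monoʳ-≤ N (1≤bl p))

  1+a≤N : suc a ≤ N
  1+a≤N = m≤n⇒m≤1+n 1+a≤m+1

  unfold : f N π ≡ transpL a (suc a) (insertAt L N (f (suc m) σ))
  unfold = begin
    f N π
      ≡⟨ trans (if-false (dec-false (posOf N π ≟ suc m) (λ e → 1+n≰n (subst (_≤ m) (trans (sym posOf-N) e) L≤m))))
               (if-true (dec-true (posOf (suc m) π <? posOf N π) (subst (posOf (suc m) π <_) (sym posOf-N) posOf-m+1<L))) ⟩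
    transpL (N ∸ bl π ∸ 1) (N ∸ bl π) (insertAt (posOf N π) N (f (suc m) (deleteVal N π)))
      ≡⟨ cong₂ (λ x y → transpL x y (insertAt (posOf N π) N (f (suc m) (deleteVal N π)))) (cong (_∸ 1) N∸bl≡1+a) N∸bl≡1+a ⟩
    transpL a (suc a) (insertAt (posOf N π) N (f (suc m) (deleteVal N π)))
      ≡⟨ cong₂ (λ q τ → transpL a (suc a) (insertAt q N (f (suc m) τ))) posOf-N deleted ⟩
    transpL a (suc a) (insertAt L N (f (suc m) σ)) ∎
    where
    open ≡-Reasoning
    posOf-N : posOf N π ≡ L
    posOf-N = posOf-split α (b ∷ β) (Unique-∉ˡ α (unique p))
    posOf-m+1<L : posOf (suc m) π < L
    posOf-m+1<L = posOf-++-∈ α (N ∷ b ∷ β) m+1∈α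

  posOf-σ : posOf (suc m) σ ≢ m
  posOf-σ e = <⇒≱ (posOf-++-∈ α (b ∷ β) m+1∈α) (subst (L ≤_) (sym e) L≤m)

  module Last (fσ-perm : Perm (suc m) (f (suc m) σ)) (fσ-ends : EndsWith (suc m) σ) where

    ys : List ℕ
    ys = proj₁ fσ-ends

    fσ≡ : f (suc m) σ ≡ ys ++ [ a ]
    fσ≡ = trans (proj₂ fσ-ends) (cong (λ k → ys ++ [ suc m ∸ k ]) bl-σ)

    L≤|ys| : L ≤ length ys
    L≤|ys| = subst (L ≤_) |ys|≡m L≤m
      where
      |ys|≡m : m ≡ length ys
      |ys|≡m = suc-injective (trans (sym (length≡ fσ-perm))
                                    (trans (cong length fσ≡) (trans (length-++ ys) (+-comm (length ys) 1))))

    ys≢a : All (_≢ a) ys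
    ys≢a = All.tabulate (λ x∈ x≡a → Unique-∉ˡ ys (subst Unique fσ≡ (unique fσ-perm)) (subst (_∈ ys) x≡a x∈))

    front back : List ℕ
    front = transpL a (suc a) (take L ys)
    back = transpL a (suc a) (drop L ys)

    unfold-split : f N π ≡ front ++ N ∷ (back ++ [ suc a ])
    unfold-split = begin
      f N π                                                 ≡⟨ unfold ⟩
      map g (insertAt L N (f (suc m) σ))                    ≡⟨ cong (λ τ → map g (insertAt L N τ)) fσ≡ ⟩
      map g (insertAt L N (ys ++ [ a ]))                    ≡⟨ cong (map g) (insertAt-++ L N ys [ a ] L≤|ys|) ⟩
      map g (insertAt L N ys ++ [ a ])                      ≡⟨ cong (λ τ → map g (τ ++ [ a ])) (insertAt-take-drop L N ys) ⟩
      map g ((take L ys ++ N ∷ drop L ys) ++ [ a ])         ≡⟨ cong (map g) (++-assoc (take L ys) (N ∷ drop L ys) [ a ]) ⟩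
      map g (take L ys ++ N ∷ (drop L ys ++ [ a ]))         ≡⟨ map-++ g (take L ys) (N ∷ (drop L ys ++ [ a ])) ⟩
      front ++ g N ∷ map g (drop L ys ++ [ a ])             ≡⟨ cong₂ (λ x τ → front ++ x ∷ τ) gN≡N (map-++ g (drop L ys) [ a ]) ⟩
      front ++ N ∷ (back ++ [ g a ])                        ≡⟨ cong (λ x → front ++ N ∷ (back ++ [ x ])) (swap-left a (suc a)) ⟩
      front ++ N ∷ (back ++ [ suc a ])                      ∎
      where
      open ≡-Reasoning
      g = swap a (suc a)
      gN≡N : g N ≡ N
      gN≡N = swap-other (λ e → 1+n≰n (subst (_≤ suc m) (sym e) (≤-trans (n≤1+n a) 1+a≤m+1)))
                        (λ e → 1+n≰n (subst (_≤ suc m) (sym e) 1+a≤m+1))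

module CaseC {m : ℕ} (α : List ℕ) (b : ℕ) (β : List ℕ)
             (p : Perm (suc (suc m)) (α ++ suc (suc m) ∷ b ∷ β)) (m+1∉α : suc m ∉ α) where

  private
    N = suc (suc m)
    π = α ++ N ∷ b ∷ β
    L = length α
    N∉α = Unique-∉ˡ α (unique p)

  L≤m : L ≤ m
  L≤m = length-before-two α N b β (length≡ p)

  ρ : List ℕ
  ρ = deleteVal N (transpL (suc m) N (b ∷ β))

  σ : List ℕ
  σ = α ++ suc m ∷ ρ

  swapped : transpL (suc m) N π ≡ α ++ suc m ∷ transpL (suc m) N (b ∷ β)
  swapped = trans (map-++ (swap (suc m) N) α (N ∷ b ∷ β))
                  (cong₂ _++_ (map-id-local (All.tabulate (λ x∈ → swap-other (λ e → m+1∉α (subst (_∈ α) e x∈))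
                                                                              (λ e → N∉α (subst (_∈ α) e x∈)))))
                              (cong (_∷ transpL (suc m) N (b ∷ β)) (swap-right (suc m) N)))

  deleted : deleteVal N (transpL (suc m) N π) ≡ σ
  deleted = trans (cong (deleteVal N) swapped)
                  (trans (filter-++ (λ y → ¬? (y ≟ N)) α (suc m ∷ transpL (suc m) N (b ∷ β)))
                         (cong₂ _++_ (deleteVal-∉ N∉α) (filter-accept (λ y → ¬? (y ≟ N)) (λ e → 1+n≢n (sym e)))))

  σ-perm : Perm (suc m) σ
  σ-perm = subst (Perm (suc m)) deleted
                 (Perm-deleteVal (Perm-transpL (s≤s z≤n , m≤n⇒m≤1+n ≤-refl) (s≤s z≤n , ≤-refl) p))

  c : ℕ
  c = N ∸ bl π

  c∈[1,m+1] : c ∈[1, suc m ]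
  c∈[1,m+1] = m<n⇒0<n∸m (s≤s (bl≤ p (∈-take-++-∷ (suc m) α N (b ∷ β) (s≤s L≤m)) ≤-refl))
            , ∸-monoʳ-≤ N (1≤bl p)

  unfold : f N π ≡ cycleL c N (f (suc m) σ ++ [ N ])
  unfold = trans (if-false (dec-false (posOf N π ≟ suc m) (λ e → 1+n≰n (subst (_≤ m) (trans (sym posOf-N) e) L≤m))))
                 (trans (if-false (dec-false (posOf (suc m) π <? posOf N π) L≤posOf-m+1))
                        (cong (λ τ → cycleL c N (f (suc m) τ ++ [ N ])) deleted))
    where
    posOf-N : posOf N π ≡ L
    posOf-N = posOf-split α (b ∷ β) N∉α
    L≤posOf-m+1 : ¬ posOf (suc m) π < posOf N π
    L≤posOf-m+1 lt = <⇒≱ (subst (posOf (suc m) π <_) posOf-N lt)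
                         (subst (L ≤_) (sym (posOf-++-∉ α (N ∷ b ∷ β) m+1∉α)) (m≤m+n L _))

  unfold-last : f N π ≡ cycleL c N (f (suc m) σ) ++ [ c ]
  unfold-last = trans unfold (trans (map-++ (rotate c N) (f (suc m) σ) [ N ])
                                    (cong (λ x → cycleL c N (f (suc m) σ) ++ [ x ]) rotate-top))

  module Last (fσ-perm : Perm (suc m) (f (suc m) σ)) where

    split : ∃₂ λ γ δ → f (suc m) σ ≡ γ ++ [ suc m ] ++ δ
    split = ∈-∃++ (complete fσ-perm (s≤s z≤n , ≤-refl))

    γ δ : List ℕ
    γ = proj₁ split
    δ = proj₁ (proj₂ split)

    fσ≡ : f (suc m) σ ≡ γ ++ suc m ∷ δ
    fσ≡ = proj₂ (proj₂ split)

    γδ-perm : Perm (suc m) (γ ++ suc m ∷ δ)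
    γδ-perm = subst (Perm (suc m)) fσ≡ fσ-perm

    unfold-split : f N π ≡ cycleL c N γ ++ N ∷ (cycleL c N δ ++ [ c ])
    unfold-split = begin
      f N π                                                        ≡⟨ unfold-last ⟩
      cycleL c N (f (suc m) σ) ++ [ c ]                            ≡⟨ cong (λ τ → cycleL c N τ ++ [ c ]) fσ≡ ⟩
      cycleL c N (γ ++ suc m ∷ δ) ++ [ c ]                         ≡⟨ cong (_++ [ c ]) (map-++ (rotate c N) γ (suc m ∷ δ)) ⟩
      (cycleL c N γ ++ rotate c N (suc m) ∷ cycleL c N δ) ++ [ c ] ≡⟨ ++-assoc (cycleL c N γ) _ [ c ] ⟩
      cycleL c N γ ++ rotate c N (suc m) ∷ (cycleL c N δ ++ [ c ]) ≡⟨ cong (λ x → cycleL c N γ ++ x ∷ (cycleL c N δ ++ [ c ]))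
                                                                           (rotate-inside (proj₂ c∈[1,m+1]) ≤-refl) ⟩
      cycleL c N γ ++ N ∷ (cycleL c N δ ++ [ c ])                  ∎
      where open ≡-Reasoning

-- Invariants of f

Perm-f-step : ∀ {m π} → (∀ {σ} → Perm (suc m) σ → Perm (suc m) (f (suc m) σ)) →
              Perm (suc (suc m)) π → Case m π → Perm (suc (suc m)) (f (suc (suc m)) π)
Perm-f-step {m} ih p (caseA α) = subst (Perm (suc (suc m))) (sym unfold) (Perm-∷ʳ (ih α-perm))
  where open CaseA α p
Perm-f-step {m} ih p (caseB α b β m+1∈α) =
  subst (Perm (suc (suc m))) (sym unfold)
        (Perm-transpL (1≤a , ≤-trans (n≤1+n a) 1+a≤N) (s≤s z≤n , 1+a≤N) (Perm-insertAt (length α) (ih σ-perm)))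
  where open CaseB α b β p m+1∈α
Perm-f-step {m} ih p (caseC α b β m+1∉α) =
  subst (Perm (suc (suc m))) (sym unfold) (Perm-cycleL (proj₁ c∈[1,m+1] , m≤n⇒m≤1+n (proj₂ c∈[1,m+1])) (Perm-∷ʳ (ih σ-perm)))
  where open CaseC α b β p m+1∉α

Perm-f : ∀ n {π} → Perm n π → Perm n (f n π)
Perm-f zero p = p
Perm-f (suc zero) p = p
Perm-f (suc (suc m)) p = Perm-f-step (Perm-f (suc m)) p (case p)

Perm-1 : ∀ {π} → Perm 1 π → π ≡ [ 1 ]
Perm-1 {[]} p with () ← length≡ p
Perm-1 {x ∷ []} p = cong [_] (≤-antisym (proj₂ (bounded p (here refl))) (proj₁ (bounded p (here refl))))
Perm-1 {x ∷ y ∷ π} p with () ← length≡ p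

endsWith-f-step : ∀ {m π} → (∀ {σ} → Perm (suc m) σ → posOf (suc m) σ ≢ m → EndsWith (suc m) σ) →
              Perm (suc (suc m)) π → Case m π → posOf (suc (suc m)) π ≢ suc m → EndsWith (suc (suc m)) π
endsWith-f-step ih p (caseA α) posOf≢ = ⊥-elim (posOf≢ posOf-N)
  where open CaseA α p
endsWith-f-step {m} ih p (caseB α b β m+1∈α) _ =
  front ++ suc (suc m) ∷ back
  , trans unfold-split (trans (sym (++-assoc front (suc (suc m) ∷ back) [ suc a ]))
                              (cong (λ x → (front ++ suc (suc m) ∷ back) ++ [ x ]) (sym N∸bl≡1+a)))
  where
  open CaseB α b β p m+1∈α
  open Last (Perm-f (suc m) σ-perm) (ih σ-perm posOf-σ)
endsWith-f-step ih p (caseC α b β m+1∉α) _ = _ , unfold-last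
  where open CaseC α b β p m+1∉α

endsWith-f : ∀ n {π} → Perm n π → posOf n π ≢ pred n → EndsWith n π
endsWith-f zero {[]} _ posOf≢ = ⊥-elim (posOf≢ refl)
endsWith-f zero {_ ∷ _} p _ with () ← length≡ p
endsWith-f (suc zero) p posOf≢ with refl ← Perm-1 p = ⊥-elim (posOf≢ refl)
endsWith-f (suc (suc m)) p = endsWith-f-step (endsWith-f (suc m)) p (case p)

records-f-step : ∀ {m π} → (∀ {σ} → Perm (suc m) σ → records 0 (f (suc m) σ) ≡ records 0 σ) →
                 Perm (suc (suc m)) π → Case m π → records 0 (f (suc (suc m)) π) ≡ records 0 π
records-f-step {m} ih p (caseA α) =
  trans (cong (records 0) unfold)
        (records-max-split-cong (subst (Perm (suc (suc m))) unfold (Perm-f (suc (suc m)) p)) p (ih α-perm))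
  where open CaseA α p
records-f-step {m} ih p (caseB α b β m+1∈α) =
  trans (cong (records 0) unfold-split)
        (records-max-split-cong (subst (Perm (suc (suc m))) unfold-split (Perm-f (suc (suc m)) p)) p records-front)
  where
  open CaseB α b β p m+1∈α
  open Last (Perm-f (suc m) σ-perm) (endsWith-f (suc m) σ-perm posOf-σ)
  L = length α
  records-front : records 0 front ≡ records 0 α
  records-front = begin
    records 0 (transpL a (suc a) (take L ys)) ≡⟨ records-map (swap-mono a) (take L ys) (All.take⁺ L ys≢a) ⟩
    records 0 (take L ys)                     ≡⟨ cong (records 0) (sym (take-++ˡ L ys [ a ] L≤|ys|)) ⟩
    records 0 (take L (ys ++ [ a ]))          ≡⟨ cong (records 0 ∘ take L) (sym fσ≡) ⟩
    records 0 (take L (f (suc m) σ))          ≡⟨ sym (take-records L 0 (f (suc m) σ)) ⟩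
    take L (records 0 (f (suc m) σ))          ≡⟨ cong (take L) (ih σ-perm) ⟩
    take L (records 0 σ)                      ≡⟨ take-records L 0 σ ⟩
    records 0 (take L σ)                      ≡⟨ cong (records 0) (take-length-++ α (b ∷ β)) ⟩
    records 0 α                               ∎
    where open ≡-Reasoning
records-f-step {m} ih p (caseC α b β m+1∉α) =
  trans (cong (records 0) unfold-split)
        (records-max-split-cong (subst (Perm (suc (suc m))) unfold-split (Perm-f (suc (suc m)) p)) p records-front)
  where
  open CaseC α b β p m+1∉α
  open Last (Perm-f (suc m) σ-perm)
  records-front : records 0 (cycleL c (suc (suc m)) γ) ≡ records 0 α
  records-front = trans (records-map (rotate-mono (m≤n⇒m≤1+n (proj₂ c∈[1,m+1]))) γ (All.map s≤s (Perm-before-max γδ-perm)))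
                        (records-max-split-injective γδ-perm σ-perm (trans (cong (records 0) (sym fσ≡)) (ih σ-perm)))

records-f : ∀ n {π} → Perm n π → records 0 (f n π) ≡ records 0 π
records-f zero _ = refl
records-f (suc zero) _ = refl
records-f (suc (suc m)) p = records-f-step (records-f (suc m)) p (case p)

lemma4p11 : (n k : ℕ) (π : List ℕ) → Bl n k π → Ltr π ≡ Ltr (f n π)
lemma4p11 n k π ((π∈Sₙ , _) , _) = Ltr-cong π (f n π) (sym (records-f n (IsPerm⇒Perm π∈Sₙ)))
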